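{- Let $q$ be a power of an odd prime. Let $P_i(X)=a_iX^{q^2}+b_iX^q+c_iX\in\mathbb{F}_q[X]$, $i=1,2,3$, be polynomials with no roots in $\mathbb{F}_{q^3}^*$. Suppose that \begin{enumerate} \item $a_1a_2a_3=b_1b_2b_3=c_1c_2c_3$, \item $a_1a_2b_3+a_1b_2a_3+b_1a_2a_3 = b_1b_2c_3+b_1c_2b_3+c_1b_2b_3 = a_1c_2c_3+c_1c_2a_3+c_1a_2c_3$, and \item $a_1a_2c_3+a_1c_2a_3+c_1a_2a_3 = b_1c_2c_3+c_1c_2b_3+c_1b_2c_3 = a_1b_2b_3+b_1a_2b_3+b_1b_2a_3$. \end{enumerate} Define $\alpha=a_1a_2a_3$, $\beta=a_1a_2b_3+a_1b_2a_3+b_1a_2a_3$, $\gamma=a_1a_2c_3+a_1c_2a_3+c_1a_2a_3$ and $\delta=a_1b_2c_3+a_1c_2b_3+b_1a_2c_3+b_1c_2a_3+c_1a_2b_3+c_1b_2a_3$. If the system $$\begin{cases} -A^2D+ABE-B^2C=2\alpha\\ A^2C-ABD-2ACD+2AE^2+B^2E-2BCE+2BD^2=2\beta\\ A^2E-ABC+2AC^2-2ADE+B^2D-2BCD+2BE^2=2\gamma\\ A^3+B^3+4C^3-12CDE+4D^3+4E^3=2\delta \end{cases}$$ has a solution $(E,A,B,C,D)\in\mathbb{F}_q^5$, then the polynomial $$f_{E,A,B,C,D}(X)=EX^2+AX^{q+1}+BX^{q^2+1}+CX^{2q}+DX^{2q^2}$$ is planar over $\mathbb{F}_{q^3}$.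
   Context: For $q$ odd, a function $f:\mathbb{F}_{q^n}\to\mathbb{F}_{q^n}$ is called planar (over $\mathbb{F}_{q^n}$) if for every $\epsilon\in\mathbb{F}_{q^n}^*$ the polynomial $f(X+\epsilon)-f(X)$ induces a permutation of $\mathbb{F}_{q^n}$. -}

module Defs where

open import Level using (0ℓ)
open import Data.Nat using (ℕ) renaming (_^_ to _^ℕ_; _+_ to _+ℕ_; _*_ to _*ℕ_)
open import Data.Fin using (Fin)
open import Data.Product using (∃)
open import Relation.Nullary using (¬_)
open import Algebra.Bundles using (CommutativeRing; Semiring)
open import Function.Bundles using (Inverse)
open import Function.Definitions using (Bijective)
import Relation.Binary.PropositionalEquality as ≡
import Algebra.Definitions.RawSemiring as RS

record FiniteField (n : ℕ) : Set₁ where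
  field
    commRing : CommutativeRing 0ℓ 0ℓ
  open CommutativeRing commRing public
  open RS (Semiring.rawSemiring semiring) public using (_^_; _×_)
  field
    0≉1     : ¬ (0# ≈ 1#)
    inverse : ∀ x → ¬ (x ≈ 0#) → ∃ λ y → x * y ≈ 1#
    card    : Inverse (≡.setoid (Fin n)) setoid

module _ (q : ℕ) (L : FiniteField (q ^ℕ 3)) where
  open FiniteField L

  InFq : Carrier → Set
  InFq x = x ^ q ≈ x

  Planar : (Carrier → Carrier) → Set
  Planar f = ∀ ε → ¬ (ε ≈ 0#) → Bijective _≈_ _≈_ (λ x → f (x + ε) - f x)

  linP : Carrier → Carrier → Carrier → Carrier → Carrier
  linP a b c x = a * x ^ (q ^ℕ 2) + b * x ^ q + c * x

  NoNonzeroRoots : (Carrier → Carrier) → Set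
  NoNonzeroRoots P = ∀ x → ¬ (x ≈ 0#) → ¬ (P x ≈ 0#)

  fEABCD : Carrier → Carrier → Carrier → Carrier → Carrier → Carrier → Carrier
  fEABCD E A B C D x =
    E * x ^ 2 + A * x ^ (q +ℕ 1) + B * x ^ (q ^ℕ 2 +ℕ 1)
    + C * x ^ (2 *ℕ q) + D * x ^ (2 *ℕ q ^ℕ 2)

{-# OPTIONS --safe #-}
-- Write x₀, x₁, x₂ for the conjugates x, x^q, x^{q²} of x ∈ F_{q³}. Then f is a quadratic form in
-- (x₀, x₁, x₂), and (f(x + ε) − f(x)) − (f(y + ε) − f(y)) is its polar form B(ε, x − y), linear in the
-- conjugates of x − y. If B(ε, z) = 0 with z ≠ 0, then B(ε, z) and its two Frobenius conjugates form a
-- 3 × 3 linear system in (z₀, z₁, z₂) with a nonzero solution, so its determinant vanishes. That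
-- determinant is 2 Σ κᵢ Sᵢ(ε₀, ε₁, ε₂) for four cyclic cubic forms Sᵢ, where κᵢ are the left-hand sides
-- of the system in the theorem, and the hypotheses turn it into 4 P₁*(ε) P₂*(ε) P₃*(ε), where
-- P*(y) = c y + a y^q + b y^{q²} is the adjoint of P(x) = a x^{q²} + b x^q + c x for the trace form.
-- So f(x + ε) − f(x) is injective, hence bijective, once no P* has a nonzero root. This follows from
-- P having none: P is then bijective, and if P*(y) = 0 with y ≠ 0, taking P(x) = 1/y gives
-- 3 = Tr(P(x) y) = Tr(x P*(y)) = 0; in characteristic 3 the circulant system P*(y) = 0 instead forces
-- (a + b + c)³ = 0, that is P(1) = 0.
module Submission where

open import Level using (0ℓ)
open import Data.Nat as ℕ using (ℕ; zero; suc; _≤_; _<_; _∸_; _!; z≤n; s≤s) renaming (_^_ to _^ℕ_)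
import Data.Nat.Properties as ℕ
open import Data.Nat.Divisibility using (_∣_; _∤_; divides; ∣-refl; ∣1⇒≡1; ∣⇒≤; m∣m*n)
open import Data.Nat.DivMod using (m/n*n≡m)
open import Data.Nat.Primality using (Prime; euclidsLemma; prime⇒nonZero; prime⇒nonTrivial; ¬prime[0]; ¬prime[1])
open import Data.Nat.Coprimality using (Coprime; coprime-Bézout; prime⇒coprime)
open import Data.Nat.GCD using (module Bézout)
open import Data.Nat.Combinatorics using (k![n∸k]!∣n!; nCn≡1) renaming (_C_ to _choose_)
open import Data.Nat.Combinatorics.Specification using (nCk≡n!/k![n-k]!)
open import Data.Integer as ℤ using (ℤ; +_; -[1+_])
import Data.Integer.Properties as ℤ
open import Data.Fin as Fin using (Fin; fromℕ; inject₁; punchIn; punchOut; #_)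
import Data.Fin.Properties as Fin
open import Data.Fin.Permutation using (Permutation′; permutation)
open import Data.Vec using (Vec; []; _∷_; _++_)
open import Data.Vec.Relation.Binary.Pointwise.Inductive as Pointwise using (Pointwise; []; _∷_)
open import Data.Maybe using (Maybe; just; nothing)
open import Data.Product using (_,_; proj₁; proj₂; ∃)
open import Data.Sum using (inj₁; inj₂)
open import Function using (_∘_; id; Congruent; Injective; Bijective)
open import Function.Bundles using (Inverse)
open import Relation.Nullary using (¬_; yes; no; contradiction)
open import Relation.Nullary.Decidable using (map′)
open import Relation.Binary.Definitions using (Decidable)
open import Relation.Binary.PropositionalEquality as ≡ using (_≡_; _≢_)
open import Algebra.Core using (Op₂)
open import Algebra.Bundles using (CommutativeRing; CommutativeMonoid; Semiring)
open import Algebra.Structures using (IsCommutativeMonoid)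
open import Algebra.Morphism.Structures using (IsRingHomomorphism)
import Algebra.Solver.Ring
import Algebra.Solver.Ring.AlmostCommutativeRing as ACR
open import Defs

module IntegerCoefficients {c ℓ} (R : CommutativeRing c ℓ) where
  open CommutativeRing R
  open import Algebra.Properties.Ring ring using (-0#≈0#; -‿involutive; -‿distribˡ-*; -‿distribʳ-*)
  open import Algebra.Properties.AbelianGroup +-abelianGroup using (⁻¹-∙-comm; xyx⁻¹≈y)
  open import Algebra.Properties.Semiring.Mult semiring using (_×_; ×-homo-+; ×1-homo-*)
  open import Relation.Binary.Reasoning.Setoid setoid

  fromℤ : ℤ → Carrier
  fromℤ (+ n)    = n × 1#
  fromℤ -[1+ n ] = - (suc n × 1#)

  fromℤ-⊖ : ∀ m n → fromℤ (m ℤ.⊖ n) ≈ m × 1# - n × 1#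
  fromℤ-⊖ m       zero    = sym (trans (+-congˡ -0#≈0#) (+-identityʳ _))
  fromℤ-⊖ zero    (suc n) = sym (+-identityˡ _)
  fromℤ-⊖ (suc m) (suc n) = begin
    fromℤ (suc m ℤ.⊖ suc n)           ≡⟨ ≡.cong fromℤ (ℤ.[1+m]⊖[1+n]≡m⊖n m n) ⟩
    fromℤ (m ℤ.⊖ n)                   ≈⟨ fromℤ-⊖ m n ⟩
    a - b                             ≈⟨ xyx⁻¹≈y 1# (a - b) ⟨
    1# + (a - b) - 1#                 ≈⟨ +-congʳ (+-assoc 1# a (- b)) ⟨
    1# + a - b - 1#                   ≈⟨ +-assoc (1# + a) (- b) (- 1#) ⟩
    (1# + a) + (- b - 1#)             ≈⟨ +-congˡ (⁻¹-∙-comm b 1#) ⟩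
    (1# + a) - (b + 1#)               ≈⟨ +-congˡ (-‿cong (+-comm b 1#)) ⟩
    (1# + a) - (1# + b)               ∎
    where
    a b : Carrier
    a = m × 1#
    b = n × 1#

  fromℤ-+ : ∀ i j → fromℤ (i ℤ.+ j) ≈ fromℤ i + fromℤ j
  fromℤ-+ (+ m)    (+ n)    = ×-homo-+ 1# m n
  fromℤ-+ (+ m)    -[1+ n ] = fromℤ-⊖ m (suc n)
  fromℤ-+ -[1+ m ] (+ n)    = trans (fromℤ-⊖ n (suc m)) (+-comm _ _)
  fromℤ-+ -[1+ m ] -[1+ n ] = begin
    - (suc (suc (m ℕ.+ n)) × 1#)      ≡⟨ ≡.cong (λ k → - (suc k × 1#)) (ℕ.+-suc m n) ⟨
    - ((suc m ℕ.+ suc n) × 1#)        ≈⟨ -‿cong (×-homo-+ 1# (suc m) (suc n)) ⟩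
    - (suc m × 1# + suc n × 1#)       ≈⟨ ⁻¹-∙-comm _ _ ⟨
    - (suc m × 1#) + - (suc n × 1#)   ∎

  fromℤ-neg : ∀ i → fromℤ (ℤ.- i) ≈ - fromℤ i
  fromℤ-neg (+ zero)  = sym -0#≈0#
  fromℤ-neg (+ suc n) = refl
  fromℤ-neg -[1+ n ]  = sym (-‿involutive _)

  private
    fromℤ-+* : ∀ m j → fromℤ (+ m ℤ.* j) ≈ fromℤ (+ m) * fromℤ j
    fromℤ-+* m (+ n)    = trans (reflexive (≡.cong fromℤ (≡.sym (ℤ.pos-* m n)))) (×1-homo-* m n)
    fromℤ-+* m -[1+ n ] = begin
      fromℤ (+ m ℤ.* ℤ.- + suc n)       ≡⟨ ≡.cong fromℤ (ℤ.neg-distribʳ-* (+ m) (+ suc n)) ⟨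
      fromℤ (ℤ.- (+ m ℤ.* + suc n))     ≈⟨ fromℤ-neg (+ m ℤ.* + suc n) ⟩
      - fromℤ (+ m ℤ.* + suc n)         ≈⟨ -‿cong (fromℤ-+* m (+ suc n)) ⟩
      - (fromℤ (+ m) * fromℤ (+ suc n)) ≈⟨ -‿distribʳ-* _ _ ⟩
      fromℤ (+ m) * fromℤ -[1+ n ]      ∎

  fromℤ-* : ∀ i j → fromℤ (i ℤ.* j) ≈ fromℤ i * fromℤ j
  fromℤ-* (+ m)    j = fromℤ-+* m j
  fromℤ-* -[1+ m ] j = begin
    fromℤ (ℤ.- + suc m ℤ.* j)         ≡⟨ ≡.cong fromℤ (ℤ.neg-distribˡ-* (+ suc m) j) ⟨
    fromℤ (ℤ.- (+ suc m ℤ.* j))       ≈⟨ fromℤ-neg (+ suc m ℤ.* j) ⟩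
    - fromℤ (+ suc m ℤ.* j)           ≈⟨ -‿cong (fromℤ-+* (suc m) j) ⟩
    - (fromℤ (+ suc m) * fromℤ j)     ≈⟨ -‿distribˡ-* _ _ ⟩
    fromℤ -[1+ m ] * fromℤ j          ∎

  fromℤ-homomorphism : CommutativeRing.rawRing ℤ.+-*-commutativeRing ACR.-Raw-AlmostCommutative⟶ ACR.fromCommutativeRing R
  fromℤ-homomorphism = record
    { ⟦_⟧ = fromℤ ; +-homo = fromℤ-+ ; *-homo = fromℤ-* ; -‿homo = fromℤ-neg
    ; 0-homo = refl ; 1-homo = +-identityʳ 1# }

  fromℤ-≟ : ∀ i j → Maybe (fromℤ i ≈ fromℤ j)
  fromℤ-≟ i j with i ℤ.≟ j
  ... | yes ≡.refl = just refl
  ... | no _       = nothing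

  open Algebra.Solver.Ring (CommutativeRing.rawRing ℤ.+-*-commutativeRing)
    (ACR.fromCommutativeRing R) fromℤ-homomorphism fromℤ-≟ public

  module _ {φ : Carrier → Carrier} (φ-hom : IsRingHomomorphism rawRing rawRing φ) where
    open IsRingHomomorphism φ-hom
    open import Algebra.Properties.Semiring.Exp semiring using (_^_; ^-congˡ)

    private
      φ-fromℕ : ∀ n → φ (n × 1#) ≈ n × 1#
      φ-fromℕ zero    = 0#-homo
      φ-fromℕ (suc n) = trans (+-homo 1# (n × 1#)) (+-cong 1#-homo (φ-fromℕ n))

      φ-fromℤ : ∀ i → φ (fromℤ i) ≈ fromℤ i
      φ-fromℤ (+ n)    = φ-fromℕ n
      φ-fromℤ -[1+ n ] = trans (-‿homo _) (-‿cong (φ-fromℕ (suc n)))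

      φ-^ : ∀ x n → φ (x ^ n) ≈ φ x ^ n
      φ-^ x zero    = 1#-homo
      φ-^ x (suc n) = trans (*-homo x (x ^ n)) (*-congˡ (φ-^ x n))

    ⟦⟧-homo : ∀ {n} (p : Polynomial n) {ρ σ : Vec Carrier n} →
              Pointwise (λ x y → φ x ≈ y) ρ σ → φ (⟦ p ⟧ ρ) ≈ ⟦ p ⟧ σ
    ⟦⟧-homo (op [+] p₁ p₂) φρ≈σ = trans (+-homo _ _) (+-cong (⟦⟧-homo p₁ φρ≈σ) (⟦⟧-homo p₂ φρ≈σ))
    ⟦⟧-homo (op [*] p₁ p₂) φρ≈σ = trans (*-homo _ _) (*-cong (⟦⟧-homo p₁ φρ≈σ) (⟦⟧-homo p₂ φρ≈σ))
    ⟦⟧-homo (con i)        φρ≈σ = φ-fromℤ i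
    ⟦⟧-homo (var x)        φρ≈σ = Pointwise.lookup φρ≈σ x
    ⟦⟧-homo (p :^ n)       φρ≈σ = trans (φ-^ _ n) (^-congˡ n (⟦⟧-homo p φρ≈σ))
    ⟦⟧-homo (:- p)         φρ≈σ = trans (-‿homo _) (-‿cong (⟦⟧-homo p φρ≈σ))

-- Each expression is written once over a RingSyntax, so that an identity between expressions can be
-- stated for ring elements and proved by the solver on the same expressions built from polynomials.
record RingSyntax {a} (T : Set a) : Set a where
  infixl 6 _+_ _-_
  infixl 7 _*_
  infix  8 -_
  infixr 8 _^_ _×_
  field
    _+_ _*_ : T → T → T
    -_      : T → T
    _^_     : T → ℕ → T
    _×_     : ℕ → T → T

  _-_ : T → T → T
  x - y = x + - y

module Expressions {a} {T : Set a} (S : RingSyntax T) where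
  open RingSyntax S

  det3 : (m₀₀ m₀₁ m₀₂ m₁₀ m₁₁ m₁₂ m₂₀ m₂₁ m₂₂ : T) → T
  det3 m₀₀ m₀₁ m₀₂ m₁₀ m₁₁ m₁₂ m₂₀ m₂₁ m₂₂ =
    m₀₀ * (m₁₁ * m₂₂ - m₁₂ * m₂₁) - m₀₁ * (m₁₀ * m₂₂ - m₁₂ * m₂₀) + m₀₂ * (m₁₀ * m₂₁ - m₁₁ * m₂₀)

  -- A triple x₀ x₁ x₂ stands for the conjugates x, x^q, x^{q²}.
  linearised : (a b c x₀ x₁ x₂ : T) → T
  linearised a b c x₀ x₁ x₂ = a * x₂ + b * x₁ + c * x₀

  adjoint : (a b c y₀ y₁ y₂ : T) → T
  adjoint a b c y₀ y₁ y₂ = c * y₀ + a * y₁ + b * y₂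

  ternaryCubic : (k₁ k₂ k₃ k₄ k₅ k₆ k₇ k₈ k₉ k₁₀ u₀ u₁ u₂ : T) → T
  ternaryCubic k₁ k₂ k₃ k₄ k₅ k₆ k₇ k₈ k₉ k₁₀ u₀ u₁ u₂ =
    k₁ * (u₀ * u₀ * u₀) + k₂ * (u₁ * u₁ * u₁) + k₃ * (u₂ * u₂ * u₂)
    + k₄ * (u₁ * u₁ * u₂) + k₅ * (u₂ * u₂ * u₀) + k₆ * (u₀ * u₀ * u₁)
    + k₇ * (u₁ * u₂ * u₂) + k₈ * (u₂ * u₀ * u₀) + k₉ * (u₀ * u₁ * u₁)
    + k₁₀ * (u₀ * u₁ * u₂)

  cyclicCubic : (k₁ k₂ k₃ k₄ u₀ u₁ u₂ : T) → T
  cyclicCubic k₁ k₂ k₃ k₄ = ternaryCubic k₁ k₁ k₁ k₂ k₂ k₂ k₃ k₃ k₃ k₄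

  module Quadratic (E A B C D : T) where

    form : (x₀ x₁ x₂ : T) → T
    form x₀ x₁ x₂ = E * (x₀ * x₀) + A * (x₁ * x₀) + B * (x₂ * x₀) + C * (x₁ * x₁) + D * (x₂ * x₂)

    -- polar u z = form (u + z) − form u − form z, as a linear form in z with coefficients polarᵢ u.
    polar₀ polar₁ polar₂ : (u₀ u₁ u₂ : T) → T
    polar₀ u₀ u₁ u₂ = 2 × E * u₀ + A * u₁ + B * u₂
    polar₁ u₀ u₁ u₂ = A * u₀ + 2 × C * u₁
    polar₂ u₀ u₁ u₂ = B * u₀ + 2 × D * u₂

    polar : (u₀ u₁ u₂ z₀ z₁ z₂ : T) → T
    polar u₀ u₁ u₂ z₀ z₁ z₂ = polar₀ u₀ u₁ u₂ * z₀ + polar₁ u₀ u₁ u₂ * z₁ + polar₂ u₀ u₁ u₂ * z₂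

    -- The determinant of the system polar u z = 0 together with its two conjugates.
    polarDet : (u₀ u₁ u₂ : T) → T
    polarDet u₀ u₁ u₂ = det3
      (polar₀ u₀ u₁ u₂) (polar₁ u₀ u₁ u₂) (polar₂ u₀ u₁ u₂)
      (polar₂ u₁ u₂ u₀) (polar₀ u₁ u₂ u₀) (polar₁ u₁ u₂ u₀)
      (polar₁ u₂ u₀ u₁) (polar₂ u₂ u₀ u₁) (polar₀ u₂ u₀ u₁)

    κ₁ κ₂ κ₃ κ₄ : T
    κ₁ = - (A ^ 2 * D) + A * B * E - B ^ 2 * C
    κ₂ = A ^ 2 * C - A * B * D - 2 × (A * C * D) + 2 × (A * E ^ 2) + B ^ 2 * E
         - 2 × (B * C * E) + 2 × (B * D ^ 2)
    κ₃ = A ^ 2 * E - A * B * C + 2 × (A * C ^ 2) - 2 × (A * D * E) + B ^ 2 * D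
         - 2 × (B * C * D) + 2 × (B * E ^ 2)
    κ₄ = A ^ 3 + B ^ 3 + 4 × (C ^ 3) - 12 × (C * D * E) + 4 × (D ^ 3) + 4 × (E ^ 3)

module RingIdentities {c ℓ} (R : CommutativeRing c ℓ) where
  open CommutativeRing R
  open IntegerCoefficients R
  open import Algebra.Definitions.RawSemiring (Semiring.rawSemiring semiring) using (_^_; _×_)
  open import Algebra.Properties.Ring ring using (-0#≈0#)
  open import Algebra.Properties.Semiring.Mult semiring using (×-congʳ)
  open import Relation.Binary.Reasoning.Setoid setoid

  carrierSyntax : RingSyntax Carrier
  carrierSyntax = record { _+_ = _+_ ; _*_ = _*_ ; -_ = -_ ; _^_ = _^_ ; _×_ = _×_ }

  polynomialSyntax : ∀ {n} → RingSyntax (Polynomial n)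
  polynomialSyntax = record { _+_ = _:+_ ; _*_ = _:*_ ; -_ = :-_ ; _^_ = _:^_ ; _×_ = _:×_ }

  open Expressions carrierSyntax public
  private module P {n} = Expressions (polynomialSyntax {n})

  det3-cramer : ∀ m₀₀ m₀₁ m₀₂ m₁₀ m₁₁ m₁₂ m₂₀ m₂₁ m₂₂ z₀ z₁ z₂ →
    det3 m₀₀ m₀₁ m₀₂ m₁₀ m₁₁ m₁₂ m₂₀ m₂₁ m₂₂ * z₀ ≈
      (m₁₁ * m₂₂ - m₁₂ * m₂₁) * (m₀₀ * z₀ + m₀₁ * z₁ + m₀₂ * z₂)
      - (m₀₁ * m₂₂ - m₀₂ * m₂₁) * (m₁₀ * z₀ + m₁₁ * z₁ + m₁₂ * z₂)
      + (m₀₁ * m₁₂ - m₀₂ * m₁₁) * (m₂₀ * z₀ + m₂₁ * z₁ + m₂₂ * z₂)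
  det3-cramer = solve 12 (λ m₀₀ m₀₁ m₀₂ m₁₀ m₁₁ m₁₂ m₂₀ m₂₁ m₂₂ z₀ z₁ z₂ →
    P.det3 m₀₀ m₀₁ m₀₂ m₁₀ m₁₁ m₁₂ m₂₀ m₂₁ m₂₂ :* z₀ :=
      (m₁₁ :* m₂₂ :- m₁₂ :* m₂₁) :* (m₀₀ :* z₀ :+ m₀₁ :* z₁ :+ m₀₂ :* z₂)
      :- (m₀₁ :* m₂₂ :- m₀₂ :* m₂₁) :* (m₁₀ :* z₀ :+ m₁₁ :* z₁ :+ m₁₂ :* z₂)
      :+ (m₀₁ :* m₁₂ :- m₀₂ :* m₁₁) :* (m₂₀ :* z₀ :+ m₂₁ :* z₁ :+ m₂₂ :* z₂)) refl

  det3-kernel : ∀ {m₀₀ m₀₁ m₀₂ m₁₀ m₁₁ m₁₂ m₂₀ m₂₁ m₂₂ z₀ z₁ z₂} →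
    m₀₀ * z₀ + m₀₁ * z₁ + m₀₂ * z₂ ≈ 0# → m₁₀ * z₀ + m₁₁ * z₁ + m₁₂ * z₂ ≈ 0# → m₂₀ * z₀ + m₂₁ * z₁ + m₂₂ * z₂ ≈ 0# →
    det3 m₀₀ m₀₁ m₀₂ m₁₀ m₁₁ m₁₂ m₂₀ m₂₁ m₂₂ * z₀ ≈ 0#
  det3-kernel {m₀₀} {m₀₁} {m₀₂} {m₁₀} {m₁₁} {m₁₂} {m₂₀} {m₂₁} {m₂₂} {z₀} {z₁} {z₂} r₀≈0 r₁≈0 r₂≈0 =
    trans (det3-cramer m₀₀ m₀₁ m₀₂ m₁₀ m₁₁ m₁₂ m₂₀ m₂₁ m₂₂ z₀ z₁ z₂) (trans
      (+-cong (+-cong (*-congˡ r₀≈0) (-‿cong (*-congˡ r₁≈0))) (*-congˡ r₂≈0))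
      (trans (+-cong (+-cong (zeroʳ _) (trans (-‿cong (zeroʳ _)) -0#≈0#)) (zeroʳ _))
        (trans (+-identityʳ _) (+-identityʳ _))))

  +-rotate : ∀ x y z → x + y + z ≈ z + x + y
  +-rotate = solve 3 (λ x y z → x :+ y :+ z := z :+ x :+ y) refl

  linearised-sub : ∀ a b c x₀ x₁ x₂ y₀ y₁ y₂ →
    linearised a b c (x₀ - y₀) (x₁ - y₁) (x₂ - y₂) ≈ linearised a b c x₀ x₁ x₂ - linearised a b c y₀ y₁ y₂
  linearised-sub = solve 9 (λ a b c x₀ x₁ x₂ y₀ y₁ y₂ →
    P.linearised a b c (x₀ :- y₀) (x₁ :- y₁) (x₂ :- y₂) := P.linearised a b c x₀ x₁ x₂ :- P.linearised a b c y₀ y₁ y₂) refl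

  trace-duality : ∀ a b c x₀ x₁ x₂ y₀ y₁ y₂ →
    linearised a b c x₀ x₁ x₂ * y₀ + linearised a b c x₁ x₂ x₀ * y₁ + linearised a b c x₂ x₀ x₁ * y₂ ≈
    x₀ * adjoint a b c y₀ y₁ y₂ + x₁ * adjoint a b c y₁ y₂ y₀ + x₂ * adjoint a b c y₂ y₀ y₁
  trace-duality = solve 9 (λ a b c x₀ x₁ x₂ y₀ y₁ y₂ →
    P.linearised a b c x₀ x₁ x₂ :* y₀ :+ P.linearised a b c x₁ x₂ x₀ :* y₁ :+ P.linearised a b c x₂ x₀ x₁ :* y₂ :=
    x₀ :* P.adjoint a b c y₀ y₁ y₂ :+ x₁ :* P.adjoint a b c y₁ y₂ y₀ :+ x₂ :* P.adjoint a b c y₂ y₀ y₁) refl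

  cube-of-sum : ∀ a b c → (a + b + c) ^ 3 ≈
    det3 c a b b c a a b c + 3 × (a ^ 2 * b + a ^ 2 * c + b ^ 2 * a + b ^ 2 * c + c ^ 2 * a + c ^ 2 * b + 3 × (a * b * c))
  cube-of-sum = solve 3 (λ a b c → (a :+ b :+ c) :^ 3 :=
    P.det3 c a b b c a a b c
      :+ 3 :× (a :^ 2 :* b :+ a :^ 2 :* c :+ b :^ 2 :* a :+ b :^ 2 :* c :+ c :^ 2 :* a :+ c :^ 2 :* b :+ 3 :× (a :* b :* c))) refl

  quadratic-second-difference : ∀ E A B C D x₀ x₁ x₂ y₀ y₁ y₂ u₀ u₁ u₂ → let open Quadratic E A B C D in
    (form (x₀ + u₀) (x₁ + u₁) (x₂ + u₂) - form x₀ x₁ x₂) - (form (y₀ + u₀) (y₁ + u₁) (y₂ + u₂) - form y₀ y₁ y₂)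
      ≈ polar u₀ u₁ u₂ (x₀ - y₀) (x₁ - y₁) (x₂ - y₂)
  quadratic-second-difference = solve 14 (λ E A B C D x₀ x₁ x₂ y₀ y₁ y₂ u₀ u₁ u₂ → let open P.Quadratic E A B C D in
    (form (x₀ :+ u₀) (x₁ :+ u₁) (x₂ :+ u₂) :- form x₀ x₁ x₂) :- (form (y₀ :+ u₀) (y₁ :+ u₁) (y₂ :+ u₂) :- form y₀ y₁ y₂)
      := polar u₀ u₁ u₂ (x₀ :- y₀) (x₁ :- y₁) (x₂ :- y₂)) refl

  polarDet-cyclicCubic : ∀ E A B C D u₀ u₁ u₂ → let open Quadratic E A B C D in
    polarDet u₀ u₁ u₂ ≈ 2 × cyclicCubic κ₁ κ₂ κ₃ κ₄ u₀ u₁ u₂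
  polarDet-cyclicCubic = solve 8 (λ E A B C D u₀ u₁ u₂ → let open P.Quadratic E A B C D in
    polarDet u₀ u₁ u₂ := 2 :× P.cyclicCubic κ₁ κ₂ κ₃ κ₄ u₀ u₁ u₂) refl

  cyclicCubic-double : ∀ k₁ k₂ k₃ k₄ u₀ u₁ u₂ →
    cyclicCubic (2 × k₁) (2 × k₂) (2 × k₃) (2 × k₄) u₀ u₁ u₂ ≈ 2 × cyclicCubic k₁ k₂ k₃ k₄ u₀ u₁ u₂
  cyclicCubic-double = solve 7 (λ k₁ k₂ k₃ k₄ u₀ u₁ u₂ →
    P.cyclicCubic (2 :× k₁) (2 :× k₂) (2 :× k₃) (2 :× k₄) u₀ u₁ u₂ := 2 :× P.cyclicCubic k₁ k₂ k₃ k₄ u₀ u₁ u₂) refl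

  adjoint-product : ∀ a₁ b₁ c₁ a₂ b₂ c₂ a₃ b₃ c₃ u₀ u₁ u₂ →
    adjoint a₁ b₁ c₁ u₀ u₁ u₂ * adjoint a₂ b₂ c₂ u₀ u₁ u₂ * adjoint a₃ b₃ c₃ u₀ u₁ u₂ ≈ ternaryCubic
      (c₁ * c₂ * c₃) (a₁ * a₂ * a₃) (b₁ * b₂ * b₃)
      (a₁ * a₂ * b₃ + a₁ * b₂ * a₃ + b₁ * a₂ * a₃)
      (b₁ * b₂ * c₃ + b₁ * c₂ * b₃ + c₁ * b₂ * b₃)
      (a₁ * c₂ * c₃ + c₁ * c₂ * a₃ + c₁ * a₂ * c₃)
      (a₁ * b₂ * b₃ + b₁ * a₂ * b₃ + b₁ * b₂ * a₃)
      (b₁ * c₂ * c₃ + c₁ * c₂ * b₃ + c₁ * b₂ * c₃)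
      (a₁ * a₂ * c₃ + a₁ * c₂ * a₃ + c₁ * a₂ * a₃)
      (a₁ * b₂ * c₃ + a₁ * c₂ * b₃ + b₁ * a₂ * c₃ + b₁ * c₂ * a₃ + c₁ * a₂ * b₃ + c₁ * b₂ * a₃)
      u₀ u₁ u₂
  adjoint-product = solve 12 (λ a₁ b₁ c₁ a₂ b₂ c₂ a₃ b₃ c₃ u₀ u₁ u₂ →
    P.adjoint a₁ b₁ c₁ u₀ u₁ u₂ :* P.adjoint a₂ b₂ c₂ u₀ u₁ u₂ :* P.adjoint a₃ b₃ c₃ u₀ u₁ u₂ := P.ternaryCubic
      (c₁ :* c₂ :* c₃) (a₁ :* a₂ :* a₃) (b₁ :* b₂ :* b₃)
      (a₁ :* a₂ :* b₃ :+ a₁ :* b₂ :* a₃ :+ b₁ :* a₂ :* a₃)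
      (b₁ :* b₂ :* c₃ :+ b₁ :* c₂ :* b₃ :+ c₁ :* b₂ :* b₃)
      (a₁ :* c₂ :* c₃ :+ c₁ :* c₂ :* a₃ :+ c₁ :* a₂ :* c₃)
      (a₁ :* b₂ :* b₃ :+ b₁ :* a₂ :* b₃ :+ b₁ :* b₂ :* a₃)
      (b₁ :* c₂ :* c₃ :+ c₁ :* c₂ :* b₃ :+ c₁ :* b₂ :* c₃)
      (a₁ :* a₂ :* c₃ :+ a₁ :* c₂ :* a₃ :+ c₁ :* a₂ :* a₃)
      (a₁ :* b₂ :* c₃ :+ a₁ :* c₂ :* b₃ :+ b₁ :* a₂ :* c₃ :+ b₁ :* c₂ :* a₃ :+ c₁ :* a₂ :* b₃ :+ c₁ :* b₂ :* a₃)
      u₀ u₁ u₂) refl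

  ternaryCubic-cong : ∀ {k₁ k₂ k₃ k₄ k₅ k₆ k₇ k₈ k₉ k₁₀ l₁ l₂ l₃ l₄ l₅ l₆ l₇ l₈ l₉ l₁₀} u₀ u₁ u₂ →
    k₁ ≈ l₁ → k₂ ≈ l₂ → k₃ ≈ l₃ → k₄ ≈ l₄ → k₅ ≈ l₅ → k₆ ≈ l₆ → k₇ ≈ l₇ → k₈ ≈ l₈ → k₉ ≈ l₉ → k₁₀ ≈ l₁₀ →
    ternaryCubic k₁ k₂ k₃ k₄ k₅ k₆ k₇ k₈ k₉ k₁₀ u₀ u₁ u₂ ≈ ternaryCubic l₁ l₂ l₃ l₄ l₅ l₆ l₇ l₈ l₉ l₁₀ u₀ u₁ u₂
  ternaryCubic-cong _ _ _ k₁≈l₁ k₂≈l₂ k₃≈l₃ k₄≈l₄ k₅≈l₅ k₆≈l₆ k₇≈l₇ k₈≈l₈ k₉≈l₉ k₁₀≈l₁₀ =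
    +-cong (+-cong (+-cong (+-cong (+-cong (+-cong (+-cong (+-cong (+-cong
      (*-congʳ k₁≈l₁) (*-congʳ k₂≈l₂)) (*-congʳ k₃≈l₃)) (*-congʳ k₄≈l₄)) (*-congʳ k₅≈l₅))
      (*-congʳ k₆≈l₆)) (*-congʳ k₇≈l₇)) (*-congʳ k₈≈l₈)) (*-congʳ k₉≈l₉)) (*-congʳ k₁₀≈l₁₀)

  adjoint-product-cyclic : ∀ {a₁ b₁ c₁ a₂ b₂ c₂ a₃ b₃ c₃} u₀ u₁ u₂ →
    let α = a₁ * a₂ * a₃
        β = a₁ * a₂ * b₃ + a₁ * b₂ * a₃ + b₁ * a₂ * a₃
        γ = a₁ * a₂ * c₃ + a₁ * c₂ * a₃ + c₁ * a₂ * a₃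
        δ = a₁ * b₂ * c₃ + a₁ * c₂ * b₃ + b₁ * a₂ * c₃ + b₁ * c₂ * a₃ + c₁ * a₂ * b₃ + c₁ * b₂ * a₃
    in
    α ≈ b₁ * b₂ * b₃ → b₁ * b₂ * b₃ ≈ c₁ * c₂ * c₃ →
    β ≈ b₁ * b₂ * c₃ + b₁ * c₂ * b₃ + c₁ * b₂ * b₃ →
    b₁ * b₂ * c₃ + b₁ * c₂ * b₃ + c₁ * b₂ * b₃ ≈ a₁ * c₂ * c₃ + c₁ * c₂ * a₃ + c₁ * a₂ * c₃ →
    γ ≈ b₁ * c₂ * c₃ + c₁ * c₂ * b₃ + c₁ * b₂ * c₃ →
    b₁ * c₂ * c₃ + c₁ * c₂ * b₃ + c₁ * b₂ * c₃ ≈ a₁ * b₂ * b₃ + b₁ * a₂ * b₃ + b₁ * b₂ * a₃ →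
    adjoint a₁ b₁ c₁ u₀ u₁ u₂ * adjoint a₂ b₂ c₂ u₀ u₁ u₂ * adjoint a₃ b₃ c₃ u₀ u₁ u₂ ≈ cyclicCubic α β γ δ u₀ u₁ u₂
  adjoint-product-cyclic {a₁} {b₁} {c₁} {a₂} {b₂} {c₂} {a₃} {b₃} {c₃} u₀ u₁ u₂ α≈b³ b³≈c³ β≈b²c b²c≈ac² γ≈bc² bc²≈ab² =
    trans (adjoint-product a₁ b₁ c₁ a₂ b₂ c₂ a₃ b₃ c₃ u₀ u₁ u₂) (ternaryCubic-cong u₀ u₁ u₂
      (sym (trans α≈b³ b³≈c³)) refl (sym α≈b³)
      refl (sym β≈b²c) (sym (trans β≈b²c b²c≈ac²))
      (sym (trans γ≈bc² bc²≈ab²)) (sym γ≈bc²) refl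
      refl)

  polarDet-cyclic : ∀ E A B C D {k₁ k₂ k₃ k₄} u₀ u₁ u₂ → let open Quadratic E A B C D in
    κ₁ ≈ 2 × k₁ → κ₂ ≈ 2 × k₂ → κ₃ ≈ 2 × k₃ → κ₄ ≈ 2 × k₄ →
    polarDet u₀ u₁ u₂ ≈ 2 × (2 × cyclicCubic k₁ k₂ k₃ k₄ u₀ u₁ u₂)
  polarDet-cyclic E A B C D {k₁} {k₂} {k₃} {k₄} u₀ u₁ u₂ κ₁≈2k₁ κ₂≈2k₂ κ₃≈2k₃ κ₄≈2k₄ = begin
    polarDet u₀ u₁ u₂
      ≈⟨ polarDet-cyclicCubic E A B C D u₀ u₁ u₂ ⟩
    2 × cyclicCubic κ₁ κ₂ κ₃ κ₄ u₀ u₁ u₂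
      ≈⟨ ×-congʳ 2 (ternaryCubic-cong u₀ u₁ u₂
           κ₁≈2k₁ κ₁≈2k₁ κ₁≈2k₁ κ₂≈2k₂ κ₂≈2k₂ κ₂≈2k₂ κ₃≈2k₃ κ₃≈2k₃ κ₃≈2k₃ κ₄≈2k₄) ⟩
    2 × cyclicCubic (2 × k₁) (2 × k₂) (2 × k₃) (2 × k₄) u₀ u₁ u₂
      ≈⟨ ×-congʳ 2 (cyclicCubic-double k₁ k₂ k₃ k₄ u₀ u₁ u₂) ⟩
    2 × (2 × cyclicCubic k₁ k₂ k₃ k₄ u₀ u₁ u₂)
      ∎
    where open Quadratic E A B C D

prime∤! : ∀ {p} → Prime p → ∀ {m} → m < p → p ∤ m !
prime∤! {p} pp {zero}  _   p∣1 = ℕ.nonTrivial⇒≢1 {{prime⇒nonTrivial pp}} (∣1⇒≡1 p∣1)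
prime∤! {p} pp {suc m} m<p p∣m! with euclidsLemma (suc m) (m !) pp p∣m!
... | inj₁ p∣1+m = ℕ.<⇒≱ m<p (∣⇒≤ p∣1+m)
... | inj₂ p∣m!  = prime∤! pp (ℕ.<-trans (ℕ.n<1+n m) m<p) p∣m!

prime∣! : ∀ {p} → Prime p → p ∣ p !
prime∣! {zero}  pp = contradiction pp ¬prime[0]
prime∣! {suc n} _  = m∣m*n (n !)

prime∣choose : ∀ {p k} → Prime p → 0 < k → k < p → p ∣ p choose k
prime∣choose {p} {k} pp 0<k k<p with euclidsLemma (p choose k) (k ! ℕ.* (p ∸ k) !) pp p∣pCk*k![p∸k]!
  where
  instance
    k![p∸k]!≢0 : ℕ.NonZero (k ! ℕ.* (p ∸ k) !)
    k![p∸k]!≢0 = ℕ._!*_!≢0 k (p ∸ k)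
  p∣pCk*k![p∸k]! : p ∣ (p choose k) ℕ.* (k ! ℕ.* (p ∸ k) !)
  p∣pCk*k![p∸k]! = ≡.subst (p ∣_) (≡.sym (≡.trans
    (≡.cong (ℕ._* (k ! ℕ.* (p ∸ k) !)) (nCk≡n!/k![n-k]! (ℕ.<⇒≤ k<p)))
    (m/n*n≡m (k![n∸k]!∣n! (ℕ.<⇒≤ k<p))))) (prime∣! pp)
... | inj₁ p∣pCk = p∣pCk
... | inj₂ p∣k!*[p∸k]! with euclidsLemma (k !) ((p ∸ k) !) pp p∣k!*[p∸k]!
...   | inj₁ p∣k!     = contradiction p∣k! (prime∤! pp k<p)
...   | inj₂ p∣[p∸k]! = contradiction p∣[p∸k]! (prime∤! pp (ℕ.∸-monoʳ-< 0<k (ℕ.<⇒≤ k<p)))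

module Characteristic {c ℓ} (R : CommutativeRing c ℓ) where
  open CommutativeRing R
  open import Algebra.Definitions.RawSemiring (Semiring.rawSemiring semiring) using (_^_; _×_)
  open import Algebra.Properties.Semiring.Mult semiring using (×-assocˡ; ×-congʳ; ×-assoc-*)
  open import Algebra.Properties.Semiring.Exp semiring using (^-congˡ; ^-assocʳ)
  open import Algebra.Properties.CommutativeSemiring.Binomial commutativeSemiring using (binomialTerm; theorem)
  open import Algebra.Properties.Monoid.Sum +-monoid using (sum; sum-init-last; sum-cong-≋; sum-replicate-zero)
  open import Relation.Binary.Reasoning.Setoid setoid

  ×-zeroʳ : ∀ n → n × 0# ≈ 0#
  ×-zeroʳ zero    = refl
  ×-zeroʳ (suc n) = trans (+-identityˡ _) (×-zeroʳ n)

  ×-annihilated : ∀ {m n} → m ∣ n → m × 1# ≈ 0# → ∀ x → n × x ≈ 0#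
  ×-annihilated {m} (divides d ≡.refl) m×1≈0 x = begin
    (d ℕ.* m) × x        ≈⟨ ×-assocˡ x d m ⟨
    d × (m × x)          ≈⟨ ×-congʳ d (×-congʳ m (*-identityˡ x)) ⟨
    d × (m × (1# * x))   ≈⟨ ×-congʳ d (×-assoc-* m 1# x) ⟨
    d × ((m × 1#) * x)   ≈⟨ ×-congʳ d (trans (*-congʳ m×1≈0) (zeroˡ x)) ⟩
    d × 0#               ≈⟨ ×-zeroʳ d ⟩
    0#                   ∎

  private
    consecutive-×1 : ∀ {a b} → a × 1# ≈ 0# → suc a ≡ b → b × 1# ≈ 0# → 1# ≈ 0#
    consecutive-×1 {a} {b} a×1≈0 1+a≡b b×1≈0 = begin
      1#            ≈⟨ +-identityʳ 1# ⟨
      1# + 0#       ≈⟨ +-congˡ a×1≈0 ⟨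
      suc a × 1#    ≡⟨ ≡.cong (_× 1#) 1+a≡b ⟩
      b × 1#        ≈⟨ b×1≈0 ⟩
      0#            ∎

  coprime-×1 : ∀ {m n} → Coprime m n → m × 1# ≈ 0# → n × 1# ≈ 0# → 1# ≈ 0#
  coprime-×1 {m} {n} coprime m×1≈0 n×1≈0 with coprime-Bézout coprime
  ... | Bézout.+- x y 1+yn≡xm =
    consecutive-×1 (×-annihilated (divides y ≡.refl) n×1≈0 1#) 1+yn≡xm (×-annihilated (divides x ≡.refl) m×1≈0 1#)
  ... | Bézout.-+ x y 1+xm≡yn =
    consecutive-×1 (×-annihilated (divides x ≡.refl) m×1≈0 1#) 1+xm≡yn (×-annihilated (divides y ≡.refl) n×1≈0 1#)

  frobenius : ∀ {p} → Prime p → p × 1# ≈ 0# → ∀ x y → (x + y) ^ p ≈ x ^ p + y ^ p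
  frobenius {zero}        pp = contradiction pp ¬prime[0]
  frobenius {suc zero}    pp = contradiction pp ¬prime[1]
  frobenius {p@(suc n@(suc _))} pp p×1≈0 x y = begin
    (x + y) ^ p                                                 ≈⟨ theorem p x y ⟩
    term Fin.zero + sum (λ i → term (Fin.suc i))                ≈⟨ +-congˡ (sum-init-last (λ i → term (Fin.suc i))) ⟩
    term Fin.zero + (sum (λ i → term (Fin.suc (inject₁ i))) + term (Fin.suc (fromℕ n)))
      ≈⟨ +-cong first (+-cong (trans (sum-cong-≋ middle) (sum-replicate-zero n)) last) ⟩
    y ^ p + (0# + x ^ p)                                        ≈⟨ +-congˡ (+-identityˡ (x ^ p)) ⟩
    y ^ p + x ^ p                                               ≈⟨ +-comm (y ^ p) (x ^ p) ⟩
    x ^ p + y ^ p                                               ∎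
    where
    term : Fin (suc p) → Carrier
    term = binomialTerm x y p
    first : term Fin.zero ≈ y ^ p
    first = trans (+-identityʳ _) (*-identityˡ (y ^ p))
    middle : ∀ i → term (Fin.suc (inject₁ i)) ≈ 0#
    middle i = ×-annihilated (prime∣choose pp (s≤s z≤n) (s≤s (Fin.inject₁ℕ< i))) p×1≈0 _
    last : term (Fin.suc (fromℕ n)) ≈ x ^ p
    last = top (≡.cong suc (Fin.toℕ-fromℕ n))
      where
      top : ∀ {k} → k ≡ p → (p choose k) × (x ^ k * y ^ (p ∸ k)) ≈ x ^ p
      top ≡.refl = begin
        (p choose p) × (x ^ p * y ^ (p ∸ p))   ≡⟨ ≡.cong₂ (λ c e → c × (x ^ p * y ^ e)) (nCn≡1 p) (ℕ.n∸n≡0 p) ⟩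
        1 × (x ^ p * 1#)                       ≈⟨ +-identityʳ _ ⟩
        x ^ p * 1#                             ≈⟨ *-identityʳ (x ^ p) ⟩
        x ^ p                                  ∎

  frobenius-^ : ∀ {p} → Prime p → p × 1# ≈ 0# → ∀ k x y → (x + y) ^ (p ℕ.^ k) ≈ x ^ (p ℕ.^ k) + y ^ (p ℕ.^ k)
  frobenius-^ pp p×1≈0 zero    x y = trans (*-identityʳ _) (sym (+-cong (*-identityʳ x) (*-identityʳ y)))
  frobenius-^ {p} pp p×1≈0 (suc k) x y = begin
    (x + y) ^ (p ℕ.* p ℕ.^ k)                   ≈⟨ ^-assocʳ (x + y) p (p ℕ.^ k) ⟨
    ((x + y) ^ p) ^ (p ℕ.^ k)                   ≈⟨ ^-congˡ (p ℕ.^ k) (frobenius pp p×1≈0 x y) ⟩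
    (x ^ p + y ^ p) ^ (p ℕ.^ k)                 ≈⟨ frobenius-^ pp p×1≈0 k (x ^ p) (y ^ p) ⟩
    (x ^ p) ^ (p ℕ.^ k) + (y ^ p) ^ (p ℕ.^ k)   ≈⟨ +-cong (^-assocʳ x p _) (^-assocʳ y p _) ⟩
    x ^ (p ℕ.* p ℕ.^ k) + y ^ (p ℕ.* p ℕ.^ k)   ∎

fin-injective⇒surjective : ∀ {n} (f : Fin n → Fin n) → Injective _≡_ _≡_ f → ∀ j → ∃ λ i → f i ≡ j
fin-injective⇒surjective {suc m} f f-inj j with Fin.any? (λ i → f i Fin.≟ j)
... | yes hit = hit
... | no miss =
  let i , i′ , i<i′ , gᵢ≡gᵢ′ = Fin.pigeonhole (ℕ.n<1+n m) (λ i → punchOut (f≢j i))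
  in  contradiction (f-inj (Fin.punchOut-injective (f≢j i) (f≢j i′) gᵢ≡gᵢ′)) (Fin.<⇒≢ i<i′)
  where
  f≢j : ∀ i → j ≢ f i
  f≢j i j≡fi = miss (i , ≡.sym j≡fi)

module FiniteFieldProperties {N : ℕ} (F : FiniteField N) where
  open FiniteField F
  open Inverse card using (to; from; from-cong; strictlyInverseˡ; strictlyInverseʳ)
  open import Algebra.Properties.AbelianGroup +-abelianGroup using (identityʳ-unique)
  open import Algebra.Properties.Semiring.Mult semiring using (×-congʳ; ×-assoc-*)
  open import Relation.Binary.Reasoning.Setoid setoid

  private
    from-injective : ∀ {x y} → from x ≡ from y → x ≈ y
    from-injective {x} {y} fx≡fy =
      trans (sym (strictlyInverseˡ x)) (trans (reflexive (≡.cong to fx≡fy)) (strictlyInverseˡ y))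

  infix 4 _≟_
  _≟_ : Decidable _≈_
  x ≟ y = map′ from-injective from-cong (from x Fin.≟ from y)

  injective⇒bijective : ∀ {f} → Congruent _≈_ _≈_ f → Injective _≈_ _≈_ f → Bijective _≈_ _≈_ f
  injective⇒bijective {f} f-cong f-inj = f-inj , surjective
    where
    f̂ : Fin N → Fin N
    f̂ i = from (f (to i))
    f̂-injective : Injective _≡_ _≡_ f̂
    f̂-injective {i} {j} f̂i≡f̂j =
      ≡.trans (≡.sym (strictlyInverseʳ i)) (≡.trans (from-cong (f-inj (from-injective f̂i≡f̂j))) (strictlyInverseʳ j))
    surjective : ∀ y → ∃ λ x → ∀ {z} → z ≈ x → f z ≈ y
    surjective y = let i , f̂i≡y = fin-injective⇒surjective f̂ f̂-injective (from y) in
      to i , λ z≈toi → trans (f-cong z≈toi) (from-injective f̂i≡y)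

  module _ {x x⁻¹ : Carrier} (xx⁻¹≈1 : x * x⁻¹ ≈ 1#) where
    x[x⁻¹w]≈w : ∀ w → x * (x⁻¹ * w) ≈ w
    x[x⁻¹w]≈w w = trans (sym (*-assoc x x⁻¹ w)) (trans (*-congʳ xx⁻¹≈1) (*-identityˡ w))

    x⁻¹[xw]≈w : ∀ w → x⁻¹ * (x * w) ≈ w
    x⁻¹[xw]≈w w = trans (sym (*-assoc x⁻¹ x w)) (trans (*-congʳ (trans (*-comm x⁻¹ x) xx⁻¹≈1)) (*-identityˡ w))

  *-cancelˡ : ∀ {x y z} → ¬ x ≈ 0# → x * y ≈ x * z → y ≈ z
  *-cancelˡ {x} {y} {z} x≉0 xy≈xz with inverse x x≉0
  ... | x⁻¹ , xx⁻¹≈1 = begin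
    y                ≈⟨ x⁻¹[xw]≈w xx⁻¹≈1 y ⟨
    x⁻¹ * (x * y)    ≈⟨ *-congˡ xy≈xz ⟩
    x⁻¹ * (x * z)    ≈⟨ x⁻¹[xw]≈w xx⁻¹≈1 z ⟩
    z                ∎

  x≉0⇒x*y≈0⇒y≈0 : ∀ {x y} → ¬ x ≈ 0# → x * y ≈ 0# → y ≈ 0#
  x≉0⇒x*y≈0⇒y≈0 {x} x≉0 xy≈0 = *-cancelˡ x≉0 (trans xy≈0 (sym (zeroʳ x)))

  n×1≉0⇒n×x≈0⇒x≈0 : ∀ {n x} → ¬ n × 1# ≈ 0# → n × x ≈ 0# → x ≈ 0#
  n×1≉0⇒n×x≈0⇒x≈0 {n} {x} n×1≉0 n×x≈0 =
    x≉0⇒x*y≈0⇒y≈0 n×1≉0 (trans (×-assoc-* n 1# x) (trans (×-congʳ n (*-identityˡ x)) n×x≈0))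

  x≉0∧y≉0⇒x*y≉0 : ∀ {x y} → ¬ x ≈ 0# → ¬ y ≈ 0# → ¬ x * y ≈ 0#
  x≉0∧y≉0⇒x*y≉0 x≉0 y≉0 = y≉0 ∘ x≉0⇒x*y≈0⇒y≈0 x≉0

  x^n≈0⇒x≈0 : ∀ {x} n → x ^ n ≈ 0# → x ≈ 0#
  x^n≈0⇒x≈0     zero    1≈0    = contradiction (sym 1≈0) 0≉1
  x^n≈0⇒x≈0 {x} (suc n) xxⁿ≈0 with x ≟ 0#
  ... | yes x≈0 = x≈0
  ... | no  x≉0 = x^n≈0⇒x≈0 n (x≉0⇒x*y≈0⇒y≈0 x≉0 xxⁿ≈0)

  module ∑Over {_∙_ : Op₂ Carrier} {ε : Carrier} (isCM : IsCommutativeMonoid _≈_ _∙_ ε) where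
    private
      M : CommutativeMonoid 0ℓ 0ℓ
      M = record { isCommutativeMonoid = isCM }

    open import Algebra.Properties.CommutativeMonoid.Sum M public
      using (sum; sum-cong-≋; sum-replicate; sum-remove; ∑-distrib-+)
    open import Algebra.Properties.CommutativeMonoid.Sum M using (sum-permute)

    ∑ : (Carrier → Carrier) → Carrier
    ∑ g = sum (λ i → g (to i))

    ∑-reindex : ∀ {g h h⁻¹} → Congruent _≈_ _≈_ g → Congruent _≈_ _≈_ h → Congruent _≈_ _≈_ h⁻¹ →
                (∀ x → h (h⁻¹ x) ≈ x) → (∀ x → h⁻¹ (h x) ≈ x) → ∑ (g ∘ h) ≈ ∑ g
    ∑-reindex {g} {h} {h⁻¹} g-cong h-cong h⁻¹-cong hh⁻¹≈id h⁻¹h≈id = begin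
      ∑ (g ∘ h)                              ≈⟨ sum-cong-≋ (λ i → g-cong (strictlyInverseˡ (h (to i)))) ⟨
      sum (λ i → g (to (from (h (to i)))))   ≈⟨ sum-permute (λ i → g (to i)) π ⟨
      ∑ g                                    ∎
      where
      π : Permutation′ N
      π = permutation (λ i → from (h (to i))) (λ i → from (h⁻¹ (to i)))
            (λ i → ≡.trans (from-cong (trans (h-cong (strictlyInverseˡ _)) (hh⁻¹≈id _))) (strictlyInverseʳ i))
            (λ i → ≡.trans (from-cong (trans (h⁻¹-cong (strictlyInverseˡ _)) (h⁻¹h≈id _))) (strictlyInverseʳ i))

  card×1≈0 : N × 1# ≈ 0#
  card×1≈0 = identityʳ-unique (∑ id) (N × 1#) (begin
    ∑ id + N × 1#               ≈⟨ +-congˡ (sum-replicate N) ⟨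
    ∑ id + sum {N} (λ _ → 1#)   ≈⟨ ∑-distrib-+ {N} to (λ _ → 1#) ⟨
    ∑ (_+ 1#)                   ≈⟨ ∑-reindex id +-congʳ +-congʳ x-1+1≈x x+1-1≈x ⟩
    ∑ id                        ∎)
    where
    open ∑Over +-isCommutativeMonoid
    x-1+1≈x : ∀ x → x - 1# + 1# ≈ x
    x-1+1≈x x = trans (+-assoc x (- 1#) 1#) (trans (+-congˡ (-‿inverseˡ 1#)) (+-identityʳ x))
    x+1-1≈x : ∀ x → x + 1# - 1# ≈ x
    x+1-1≈x x = trans (+-assoc x 1# (- 1#)) (trans (+-congˡ (-‿inverseʳ 1#)) (+-identityʳ x))

  -- Fermat: multiplication by a ≉ 0 permutes the field, and comparing the products of unitPart
  -- (the identity with 0 replaced by 1) before and after gives a ^ (N − 1) ≈ 1.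
  private
    unitPart : Carrier → Carrier
    unitPart x with x ≟ 0#
    ... | yes _ = 1#
    ... | no  _ = x

    unitPart-cong : Congruent _≈_ _≈_ unitPart
    unitPart-cong {x} {y} x≈y with x ≟ 0# | y ≟ 0#
    ... | yes _   | yes _   = refl
    ... | yes x≈0 | no  y≉0 = contradiction (trans (sym x≈y) x≈0) y≉0
    ... | no  x≉0 | yes y≈0 = contradiction (trans x≈y y≈0) x≉0
    ... | no  _   | no  _   = x≈y

    unitPart≉0 : ∀ x → ¬ unitPart x ≈ 0#
    unitPart≉0 x with x ≟ 0#
    ... | yes _   = 0≉1 ∘ sym
    ... | no  x≉0 = x≉0

  module _ {a : Carrier} (a≉0 : ¬ a ≈ 0#) where
    open ∑Over *-isCommutativeMonoid
      renaming (∑ to ∏; sum to product; sum-cong-≋ to product-cong; sum-remove to product-remove;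
                sum-replicate to product-replicate; ∑-distrib-+ to ∏-distrib-*)

    private
      scale : Carrier → Carrier
      scale x with x ≟ 0#
      ... | yes _ = 1#
      ... | no  _ = a

      unitPart-* : ∀ x → unitPart (a * x) ≈ scale x * unitPart x
      unitPart-* x with x ≟ 0# | a * x ≟ 0#
      ... | yes _   | yes _    = sym (*-identityˡ 1#)
      ... | yes x≈0 | no  ax≉0 = contradiction (trans (*-congˡ x≈0) (zeroʳ a)) ax≉0
      ... | no  x≉0 | yes ax≈0 = contradiction (x≉0⇒x*y≈0⇒y≈0 a≉0 ax≈0) x≉0
      ... | no  _   | no  _    = refl

      product-nonzero : ∀ {n} (t : Fin n → Carrier) → (∀ i → ¬ t i ≈ 0#) → ¬ product t ≈ 0#
      product-nonzero {zero}  t t≉0 = 0≉1 ∘ sym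
      product-nonzero {suc n} t t≉0 = x≉0∧y≉0⇒x*y≉0 (t≉0 Fin.zero) (product-nonzero (t ∘ Fin.suc) (t≉0 ∘ Fin.suc))

      ∏scale≈1 : ∏ scale ≈ 1#
      ∏scale≈1 = *-cancelˡ P≉0 (begin
        P * ∏ scale                      ≈⟨ *-comm P _ ⟩
        ∏ scale * P                      ≈⟨ ∏-distrib-* {N} (scale ∘ to) (unitPart ∘ to) ⟨
        ∏ (λ x → scale x * unitPart x)   ≈⟨ product-cong (λ i → unitPart-* (to i)) ⟨
        ∏ (unitPart ∘ (a *_))            ≈⟨ ∑-reindex unitPart-cong *-congˡ *-congˡ (x[x⁻¹w]≈w aa⁻¹≈1) (x⁻¹[xw]≈w aa⁻¹≈1) ⟩
        P                                ≈⟨ *-identityʳ P ⟨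
        P * 1#                           ∎)
        where
        P : Carrier
        P = ∏ unitPart
        P≉0 : ¬ P ≈ 0#
        P≉0 = product-nonzero (unitPart ∘ to) (unitPart≉0 ∘ to)
        aa⁻¹≈1 : a * proj₁ (inverse a a≉0) ≈ 1#
        aa⁻¹≈1 = proj₂ (inverse a a≉0)

      ∏scale≈a^[N-1] : ∏ scale ≈ a ^ ℕ.pred N
      ∏scale≈a^[N-1] = product-with-one-exception (scale ∘ to) (from 0#)
        (scale-zero (strictlyInverseˡ 0#))
        (λ j j≢0 → scale-nonzero (λ toj≈0 → j≢0 (≡.trans (≡.sym (strictlyInverseʳ j)) (from-cong toj≈0))))
        where
        scale-zero : ∀ {x} → x ≈ 0# → scale x ≈ 1#
        scale-zero {x} x≈0 with x ≟ 0#
        ... | yes _   = refl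
        ... | no  x≉0 = contradiction x≈0 x≉0
        scale-nonzero : ∀ {x} → ¬ x ≈ 0# → scale x ≈ a
        scale-nonzero {x} x≉0 with x ≟ 0#
        ... | yes x≈0 = contradiction x≈0 x≉0
        ... | no  _   = refl
        product-with-one-exception : ∀ {n} (t : Fin n → Carrier) i → t i ≈ 1# → (∀ j → j ≢ i → t j ≈ a) →
                                     product t ≈ a ^ ℕ.pred n
        product-with-one-exception {suc n} t i tᵢ≈1 tⱼ≈a = begin
          product t                            ≈⟨ product-remove t ⟩
          t i * product (t ∘ punchIn i)        ≈⟨ *-cong tᵢ≈1 (product-cong (λ j → tⱼ≈a _ (Fin.punchInᵢ≢i i j))) ⟩
          1# * product {n} (λ _ → a)           ≈⟨ *-identityˡ _ ⟩
          product {n} (λ _ → a)                ≈⟨ product-replicate n ⟩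
          a ^ n                                ∎

    x≉0⇒x^[N-1]≈1 : a ^ ℕ.pred N ≈ 1#
    x≉0⇒x^[N-1]≈1 = trans (sym ∏scale≈a^[N-1]) ∏scale≈1

  fermat : ∀ x → x ^ N ≈ x
  fermat x = begin
    x ^ N                ≡⟨ ≡.cong (x ^_) (ℕ.suc-pred N {{Fin.nonZeroIndex (from 0#)}}) ⟨
    x * x ^ ℕ.pred N     ≈⟨ x*x^[N-1]≈x ⟩
    x                    ∎
    where
    x*x^[N-1]≈x : x * x ^ ℕ.pred N ≈ x
    x*x^[N-1]≈x with x ≟ 0#
    ... | yes x≈0 = trans (*-congʳ x≈0) (trans (zeroˡ _) (sym x≈0))
    ... | no  x≉0 = trans (*-congˡ (x≉0⇒x^[N-1]≈1 x≉0)) (*-identityʳ x)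

module CubicExtension {N : ℕ} (F : FiniteField N) {φ : FiniteField.Carrier F → FiniteField.Carrier F}
  (φ-isRingHomomorphism : IsRingHomomorphism (FiniteField.rawRing F) (FiniteField.rawRing F) φ)
  (φ³≈id : ∀ x → FiniteField._≈_ F (φ (φ (φ x))) x) where

  open FiniteField F

  open FiniteFieldProperties F
  open IntegerCoefficients commRing using (Polynomial; var; ⟦_⟧; _:*_; ⟦⟧-homo)
  open RingIdentities commRing
  open Characteristic commRing using (×-annihilated)
  open IsRingHomomorphism φ-isRingHomomorphism
    renaming (⟦⟧-cong to φ-cong; +-homo to φ-+; -‿homo to φ-neg; 1#-homo to φ-1; 0#-homo to φ-0)
  open import Algebra.Properties.AbelianGroup +-abelianGroup using (x∙y⁻¹≈ε⇒x≈y; x≈y⇒x∙y⁻¹≈ε)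
  open import Relation.Binary.Reasoning.Setoid setoid
  private module P {n} = Expressions (polynomialSyntax {n})

  Fixed : Carrier → Set
  Fixed x = φ x ≈ x

  φ-sub : ∀ x y → φ (x - y) ≈ φ x - φ y
  φ-sub x y = trans (φ-+ x (- y)) (+-congˡ (φ-neg y))

  private
    infix 4 _↦_
    _↦_ : ∀ {n} → Vec Carrier n → Vec Carrier n → Set
    ρ ↦ σ = Pointwise (λ x y → φ x ≈ y) ρ σ

    -- φ rotates the triple of conjugates of x once, by φ³≈id.
    conj₀ conj₁ conj₂ : Carrier → Vec Carrier 3
    conj₀ x = x ∷ φ x ∷ φ (φ x) ∷ []
    conj₁ x = φ x ∷ φ (φ x) ∷ x ∷ []
    conj₂ x = φ (φ x) ∷ x ∷ φ x ∷ []

    conj₀↦conj₁ : ∀ x → conj₀ x ↦ conj₁ x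
    conj₀↦conj₁ x = refl ∷ refl ∷ φ³≈id x ∷ []

    conj₁↦conj₂ : ∀ x → conj₁ x ↦ conj₂ x
    conj₁↦conj₂ x = refl ∷ φ³≈id x ∷ refl ∷ []

    φ-invariant : ∀ {n} (p : Polynomial n) {ρ σ v} → ρ ↦ σ → Fixed v → ⟦ p ⟧ ρ ≈ v → ⟦ p ⟧ σ ≈ v
    φ-invariant p ρ↦σ φv≈v pρ≈v = trans (sym (⟦⟧-homo φ-isRingHomomorphism p ρ↦σ)) (trans (φ-cong pρ≈v) φv≈v)

  module LinearisedPolynomial {a b c : Carrier} (Fa : Fixed a) (Fb : Fixed b) (Fc : Fixed c) where

    P P* : Carrier → Carrier
    P  x = linearised a b c x (φ x) (φ (φ x))
    P* y = adjoint a b c y (φ y) (φ (φ y))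

    P-cong : Congruent _≈_ _≈_ P
    P-cong x≈y = +-cong (+-cong (*-congˡ (φ-cong (φ-cong x≈y))) (*-congˡ (φ-cong x≈y))) (*-congˡ x≈y)

    P-sub : ∀ x y → P (x - y) ≈ P x - P y
    P-sub x y = trans
      (+-congʳ (+-cong (*-congˡ (trans (φ-cong (φ-sub x y)) (φ-sub _ _))) (*-congˡ (φ-sub x y))))
      (linearised-sub a b c x (φ x) (φ (φ x)) y (φ y) (φ (φ y)))

    module _ (P-noNonzeroRoots : ∀ x → ¬ x ≈ 0# → ¬ P x ≈ 0#) where

      P-injective : Injective _≈_ _≈_ P
      P-injective {x} {y} Px≈Py with x - y ≟ 0#
      ... | yes x-y≈0 = x∙y⁻¹≈ε⇒x≈y x y x-y≈0
      ... | no  x-y≉0 = contradiction (trans (P-sub x y) (x≈y⇒x∙y⁻¹≈ε Px≈Py)) (P-noNonzeroRoots (x - y) x-y≉0)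

      private
        trace-argument : ¬ 3 × 1# ≈ 0# → ∀ y → ¬ y ≈ 0# → ¬ P* y ≈ 0#
        trace-argument 3≉0 y y≉0 P*y≈0 = 3≉0 (begin
          3 × 1#                                            ≈⟨ +-congˡ (+-congˡ (+-identityʳ 1#)) ⟩
          1# + (1# + 1#)                                    ≈⟨ +-assoc 1# 1# 1# ⟨
          1# + 1# + 1#                                      ≈⟨ +-cong (+-cong T₀≈1 T₁≈1) T₂≈1 ⟨
          ⟦ Tₚ ⟧ ρ₀ + ⟦ Tₚ ⟧ ρ₁ + ⟦ Tₚ ⟧ ρ₂                  ≈⟨ trace-duality a b c x (φ x) (φ (φ x)) y (φ y) (φ (φ y)) ⟩
          ⟦ Sₚ ⟧ ρ₀ + ⟦ Sₚ ⟧ ρ₁ + ⟦ Sₚ ⟧ ρ₂                  ≈⟨ +-cong (+-cong S₀≈0 S₁≈0) S₂≈0 ⟩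
          0# + 0# + 0#                                      ≈⟨ trans (+-identityʳ _) (+-identityʳ 0#) ⟩
          0#                                                ∎)
          where
          y⁻¹ : Carrier
          y⁻¹ = proj₁ (inverse y y≉0)
          x : Carrier
          x = proj₁ (proj₂ (injective⇒bijective P-cong P-injective) y⁻¹)
          Px≈y⁻¹ : P x ≈ y⁻¹
          Px≈y⁻¹ = proj₂ (proj₂ (injective⇒bijective P-cong P-injective) y⁻¹) refl
          ρ₀ ρ₁ ρ₂ : Vec Carrier 9
          ρ₀ = a ∷ b ∷ c ∷ conj₀ x ++ conj₀ y
          ρ₁ = a ∷ b ∷ c ∷ conj₁ x ++ conj₁ y
          ρ₂ = a ∷ b ∷ c ∷ conj₂ x ++ conj₂ y
          ρ₀↦ρ₁ : ρ₀ ↦ ρ₁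
          ρ₀↦ρ₁ = Fa ∷ Fb ∷ Fc ∷ Pointwise.++⁺ (conj₀↦conj₁ x) (conj₀↦conj₁ y)
          ρ₁↦ρ₂ : ρ₁ ↦ ρ₂
          ρ₁↦ρ₂ = Fa ∷ Fb ∷ Fc ∷ Pointwise.++⁺ (conj₁↦conj₂ x) (conj₁↦conj₂ y)
          Tₚ Sₚ : Polynomial 9
          Tₚ = P.linearised (var (# 0)) (var (# 1)) (var (# 2)) (var (# 3)) (var (# 4)) (var (# 5)) :* var (# 6)
          Sₚ = var (# 3) :* P.adjoint (var (# 0)) (var (# 1)) (var (# 2)) (var (# 6)) (var (# 7)) (var (# 8))
          T₀≈1 : ⟦ Tₚ ⟧ ρ₀ ≈ 1#
          T₀≈1 = trans (*-congʳ Px≈y⁻¹) (trans (*-comm y⁻¹ y) (proj₂ (inverse y y≉0)))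
          T₁≈1 : ⟦ Tₚ ⟧ ρ₁ ≈ 1#
          T₁≈1 = φ-invariant Tₚ ρ₀↦ρ₁ φ-1 T₀≈1
          T₂≈1 : ⟦ Tₚ ⟧ ρ₂ ≈ 1#
          T₂≈1 = φ-invariant Tₚ ρ₁↦ρ₂ φ-1 T₁≈1
          S₀≈0 : ⟦ Sₚ ⟧ ρ₀ ≈ 0#
          S₀≈0 = trans (*-congˡ P*y≈0) (zeroʳ x)
          S₁≈0 : ⟦ Sₚ ⟧ ρ₁ ≈ 0#
          S₁≈0 = φ-invariant Sₚ ρ₀↦ρ₁ φ-0 S₀≈0
          S₂≈0 : ⟦ Sₚ ⟧ ρ₂ ≈ 0#
          S₂≈0 = φ-invariant Sₚ ρ₁↦ρ₂ φ-0 S₁≈0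

        circulant-argument : 3 × 1# ≈ 0# → ∀ y → ¬ y ≈ 0# → ¬ P* y ≈ 0#
        circulant-argument 3≈0 y y≉0 P*y≈0 = P-noNonzeroRoots 1# (0≉1 ∘ sym) (begin
          P 1#                                  ≈⟨ +-cong (+-cong (*-congˡ (trans (φ-cong φ-1) φ-1)) (*-congˡ φ-1)) refl ⟩
          a * 1# + b * 1# + c * 1#              ≈⟨ +-cong (+-cong (*-identityʳ a) (*-identityʳ b)) (*-identityʳ c) ⟩
          a + b + c                             ≈⟨ x^n≈0⇒x≈0 3 [a+b+c]³≈0 ⟩
          0#                                    ∎)
          where
          Aₚ : Polynomial 6
          Aₚ = P.adjoint (var (# 0)) (var (# 1)) (var (# 2)) (var (# 3)) (var (# 4)) (var (# 5))
          P*₁≈0 : adjoint a b c (φ y) (φ (φ y)) y ≈ 0#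
          P*₁≈0 = φ-invariant Aₚ (Fa ∷ Fb ∷ Fc ∷ conj₀↦conj₁ y) φ-0 P*y≈0
          P*₂≈0 : adjoint a b c (φ (φ y)) y (φ y) ≈ 0#
          P*₂≈0 = φ-invariant Aₚ (Fa ∷ Fb ∷ Fc ∷ conj₁↦conj₂ y) φ-0 P*₁≈0
          circulant≈0 : det3 c a b b c a a b c ≈ 0#
          circulant≈0 = x≉0⇒x*y≈0⇒y≈0 y≉0 (trans (*-comm y _) (det3-kernel P*y≈0
            (trans (sym (+-rotate _ _ _)) P*₁≈0) (trans (+-rotate _ _ _) P*₂≈0)))
          [a+b+c]³≈0 : (a + b + c) ^ 3 ≈ 0#
          [a+b+c]³≈0 = trans (cube-of-sum a b c)
            (trans (+-cong circulant≈0 (×-annihilated {3} ∣-refl 3≈0 _)) (+-identityʳ 0#))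

      P*-noNonzeroRoots : ∀ y → ¬ y ≈ 0# → ¬ P* y ≈ 0#
      P*-noNonzeroRoots with 3 × 1# ≟ 0#
      ... | yes 3≈0 = circulant-argument 3≈0
      ... | no  3≉0 = trace-argument 3≉0

  module QuadraticForm {E A B C D : Carrier}
    (FE : Fixed E) (FA : Fixed A) (FB : Fixed B) (FC : Fixed C) (FD : Fixed D) where
    open Quadratic E A B C D

    Q : Carrier → Carrier
    Q x = form x (φ x) (φ (φ x))

    private
      form-cong : ∀ {x₀ x₁ x₂ y₀ y₁ y₂} → x₀ ≈ y₀ → x₁ ≈ y₁ → x₂ ≈ y₂ → form x₀ x₁ x₂ ≈ form y₀ y₁ y₂
      form-cong x₀≈y₀ x₁≈y₁ x₂≈y₂ = +-cong (+-cong (+-cong (+-cong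
        (*-congˡ (*-cong x₀≈y₀ x₀≈y₀)) (*-congˡ (*-cong x₁≈y₁ x₀≈y₀))) (*-congˡ (*-cong x₂≈y₂ x₀≈y₀)))
        (*-congˡ (*-cong x₁≈y₁ x₁≈y₁))) (*-congˡ (*-cong x₂≈y₂ x₂≈y₂))

      polar-congʳ : ∀ {u₀ u₁ u₂ x₀ x₁ x₂ y₀ y₁ y₂} → x₀ ≈ y₀ → x₁ ≈ y₁ → x₂ ≈ y₂ →
                    polar u₀ u₁ u₂ x₀ x₁ x₂ ≈ polar u₀ u₁ u₂ y₀ y₁ y₂
      polar-congʳ x₀≈y₀ x₁≈y₁ x₂≈y₂ = +-cong (+-cong (*-congˡ x₀≈y₀) (*-congˡ x₁≈y₁)) (*-congˡ x₂≈y₂)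

      Q-cong : Congruent _≈_ _≈_ Q
      Q-cong x≈y = form-cong x≈y (φ-cong x≈y) (φ-cong (φ-cong x≈y))

      Q-+ : ∀ x u → Q (x + u) ≈ form (x + u) (φ x + φ u) (φ (φ x) + φ (φ u))
      Q-+ x u = form-cong refl (φ-+ x u) (trans (φ-cong (φ-+ x u)) (φ-+ _ _))

    polar-second-difference : ∀ x y u →
      (Q (x + u) - Q x) - (Q (y + u) - Q y) ≈ polar u (φ u) (φ (φ u)) (x - y) (φ (x - y)) (φ (φ (x - y)))
    polar-second-difference x y u = begin
      (Q (x + u) - Q x) - (Q (y + u) - Q y)
        ≈⟨ +-cong (+-congʳ (Q-+ x u)) (-‿cong (+-congʳ (Q-+ y u))) ⟩
      (form (x + u) (φ x + φ u) (φ (φ x) + φ (φ u)) - Q x) - (form (y + u) (φ y + φ u) (φ (φ y) + φ (φ u)) - Q y)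
        ≈⟨ quadratic-second-difference E A B C D x (φ x) (φ (φ x)) y (φ y) (φ (φ y)) u (φ u) (φ (φ u)) ⟩
      polar u (φ u) (φ (φ u)) (x - y) (φ x - φ y) (φ (φ x) - φ (φ y))
        ≈⟨ polar-congʳ refl (φ-sub x y) (trans (φ-cong (φ-sub x y)) (φ-sub _ _)) ⟨
      polar u (φ u) (φ (φ u)) (x - y) (φ (x - y)) (φ (φ (x - y)))
        ∎

    polar≈0⇒polarDet≈0 : ∀ {u z} → ¬ z ≈ 0# →
      polar u (φ u) (φ (φ u)) z (φ z) (φ (φ z)) ≈ 0# → polarDet u (φ u) (φ (φ u)) ≈ 0#
    polar≈0⇒polarDet≈0 {u} {z} z≉0 polar₀≈0 = x≉0⇒x*y≈0⇒y≈0 z≉0 (trans (*-comm z _)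
      (det3-kernel polar₀≈0 (trans (sym (+-rotate _ _ _)) polar₁≈0) (trans (+-rotate _ _ _) polar₂≈0)))
      where
      Bₚ : Polynomial 11
      Bₚ = P.Quadratic.polar (var (# 0)) (var (# 1)) (var (# 2)) (var (# 3)) (var (# 4))
             (var (# 5)) (var (# 6)) (var (# 7)) (var (# 8)) (var (# 9)) (var (# 10))
      polar₁≈0 : polar (φ u) (φ (φ u)) u (φ z) (φ (φ z)) z ≈ 0#
      polar₁≈0 = φ-invariant Bₚ (FE ∷ FA ∷ FB ∷ FC ∷ FD ∷ Pointwise.++⁺ (conj₀↦conj₁ u) (conj₀↦conj₁ z)) φ-0 polar₀≈0
      polar₂≈0 : polar (φ (φ u)) u (φ u) (φ (φ z)) z (φ z) ≈ 0#
      polar₂≈0 = φ-invariant Bₚ (FE ∷ FA ∷ FB ∷ FC ∷ FD ∷ Pointwise.++⁺ (conj₁↦conj₂ u) (conj₁↦conj₂ z)) φ-0 polar₁≈0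

    planar : (∀ u → ¬ u ≈ 0# → ¬ polarDet u (φ u) (φ (φ u)) ≈ 0#) →
             ∀ {f : Carrier → Carrier} → (∀ x → f x ≈ Q x) → ∀ ε → ¬ ε ≈ 0# → Bijective _≈_ _≈_ (λ x → f (x + ε) - f x)
    planar polarDet≉0 {f} f≈Q ε ε≉0 = injective⇒bijective {Δ} Δ-cong Δ-injective
      where
      Δ : Carrier → Carrier
      Δ x = f (x + ε) - f x
      Δ≈ : ∀ x → Δ x ≈ Q (x + ε) - Q x
      Δ≈ x = +-cong (f≈Q (x + ε)) (-‿cong (f≈Q x))
      Δ-cong : Congruent _≈_ _≈_ Δ
      Δ-cong {x} {y} x≈y = trans (Δ≈ x) (trans (+-cong (Q-cong (+-congʳ x≈y)) (-‿cong (Q-cong x≈y))) (sym (Δ≈ y)))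
      Δ-injective : Injective _≈_ _≈_ Δ
      Δ-injective {x} {y} Δx≈Δy with x - y ≟ 0#
      ... | yes x-y≈0 = x∙y⁻¹≈ε⇒x≈y x y x-y≈0
      ... | no  x-y≉0 = contradiction (polar≈0⇒polarDet≈0 x-y≉0 (begin
        polar ε (φ ε) (φ (φ ε)) (x - y) (φ (x - y)) (φ (φ (x - y)))  ≈⟨ polar-second-difference x y ε ⟨
        (Q (x + ε) - Q x) - (Q (y + ε) - Q y)                       ≈⟨ +-cong (Δ≈ x) (-‿cong (Δ≈ y)) ⟨
        Δ x - Δ y                                                   ≈⟨ x≈y⇒x∙y⁻¹≈ε Δx≈Δy ⟩
        0#                                                          ∎)) (polarDet≉0 ε ε≉0)

module FrobeniusOfCubicExtension (q p k : ℕ) (p-prime : Prime p) (q≡pᵏ : q ≡ p ℕ.^ k) (L : FiniteField (q ℕ.^ 3)) where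
  open FiniteField L
  open FiniteFieldProperties L
  open Characteristic commRing using (frobenius-^; coprime-×1)
  open RingIdentities commRing using (linearised; module Quadratic)
  open import Algebra.Properties.Semiring.Mult semiring using (×1-homo-*)
  open import Algebra.Properties.Semiring.Exp semiring using (^-congˡ; ^-assocʳ; ^-homo-*)
  open import Algebra.Properties.CommutativeSemiring.Exp commutativeSemiring using (^-distrib-*)
  open import Algebra.Properties.AbelianGroup +-abelianGroup using (inverseʳ-unique)
  open import Relation.Binary.Reasoning.Setoid setoid

  φ : Carrier → Carrier
  φ x = x ^ q

  private
    instance
      p≢0 : ℕ.NonZero p
      p≢0 = prime⇒nonZero p-prime

    ×1-^ : ∀ m n → (m × 1#) ^ n ≈ (m ℕ.^ n) × 1#
    ×1-^ m zero    = sym (+-identityʳ 1#)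
    ×1-^ m (suc n) = trans (*-congˡ (×1-^ m n)) (sym (×1-homo-* m (m ℕ.^ n)))

    1^n≈1 : ∀ n → 1# ^ n ≈ 1#
    1^n≈1 zero    = refl
    1^n≈1 (suc n) = trans (*-identityˡ _) (1^n≈1 n)

  p×1≈0 : p × 1# ≈ 0#
  p×1≈0 = x^n≈0⇒x≈0 (k ℕ.* 3) (begin
    (p × 1#) ^ (k ℕ.* 3)      ≈⟨ ×1-^ p (k ℕ.* 3) ⟩
    (p ℕ.^ (k ℕ.* 3)) × 1#    ≡⟨ ≡.cong (λ n → n × 1#) (≡.trans (≡.sym (ℕ.^-*-assoc p k 3)) (≡.cong (ℕ._^ 3) (≡.sym q≡pᵏ))) ⟩
    (q ℕ.^ 3) × 1#            ≈⟨ card×1≈0 ⟩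
    0#                        ∎)

  2×1≉0 : ¬ p ≡ 2 → ¬ 2 × 1# ≈ 0#
  2×1≉0 p≢2 2×1≈0 = 0≉1 (sym (coprime-×1 (prime⇒coprime p-prime 2<p) p×1≈0 2×1≈0))
    where
    2<p : 2 < p
    2<p = ℕ.≤∧≢⇒< (ℕ.nonTrivial⇒n>1 p {{prime⇒nonTrivial p-prime}}) (p≢2 ∘ ≡.sym)

  φ-+ : ∀ x y → φ (x + y) ≈ φ x + φ y
  φ-+ x y = ≡.subst (λ n → (x + y) ^ n ≈ x ^ n + y ^ n) (≡.sym q≡pᵏ) (frobenius-^ p-prime p×1≈0 k x y)

  φ-0 : φ 0# ≈ 0#
  φ-0 = ≡.subst (λ n → 0# ^ n ≈ 0#) (ℕ.suc-pred q {{q≢0}}) (zeroˡ _)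
    where
    q≢0 : ℕ.NonZero q
    q≢0 = ≡.subst ℕ.NonZero (≡.sym q≡pᵏ) (ℕ.m^n≢0 p k)

  φ-isRingHomomorphism : IsRingHomomorphism rawRing rawRing φ
  φ-isRingHomomorphism = record
    { isSemiringHomomorphism = record
      { isNearSemiringHomomorphism = record
        { +-isMonoidHomomorphism = record
          { isMagmaHomomorphism = record { isRelHomomorphism = record { cong = ^-congˡ q } ; homo = φ-+ }
          ; ε-homo = φ-0 }
        ; *-homo = λ x y → ^-distrib-* x y q }
      ; 1#-homo = 1^n≈1 q }
    ; -‿homo = λ x → inverseʳ-unique (φ x) (φ (- x)) (trans (sym (φ-+ x (- x))) (trans (^-congˡ q (-‿inverseʳ x)) φ-0)) }

  φ³≈id : ∀ x → φ (φ (φ x)) ≈ x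
  φ³≈id x = begin
    ((x ^ q) ^ q) ^ q         ≈⟨ ^-congˡ q (^-assocʳ x q q) ⟩
    (x ^ (q ℕ.* q)) ^ q       ≈⟨ ^-assocʳ x (q ℕ.* q) q ⟩
    x ^ (q ℕ.* q ℕ.* q)       ≡⟨ ≡.cong (x ^_) q*q*q≡q³ ⟩
    x ^ (q ℕ.^ 3)             ≈⟨ fermat x ⟩
    x                         ∎
    where
    q*q*q≡q³ : q ℕ.* q ℕ.* q ≡ q ℕ.^ 3
    q*q*q≡q³ = ≡.trans (ℕ.*-assoc q q q) (≡.cong (λ n → q ℕ.* (q ℕ.* n)) (≡.sym (ℕ.*-identityʳ q)))

  private
    x^[q²]≈φ²x : ∀ x → x ^ (q ℕ.^ 2) ≈ φ (φ x)
    x^[q²]≈φ²x x = sym (trans (^-assocʳ x q q) (reflexive (≡.cong (λ n → x ^ (q ℕ.* n)) (≡.sym (ℕ.*-identityʳ q)))))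

    x^[2n]≈[xⁿ]² : ∀ x n → x ^ (2 ℕ.* n) ≈ x ^ n * x ^ n
    x^[2n]≈[xⁿ]² x n =
      trans (reflexive (≡.cong (x ^_) (ℕ.*-comm 2 n))) (trans (sym (^-assocʳ x n 2)) (*-congˡ (*-identityʳ _)))

  linP≈linearised : ∀ a b c x → linP q L a b c x ≈ linearised a b c x (φ x) (φ (φ x))
  linP≈linearised a b c x = +-congʳ (+-congʳ (*-congˡ (x^[q²]≈φ²x x)))

  fEABCD≈form : ∀ E A B C D x → fEABCD q L E A B C D x ≈ Quadratic.form E A B C D x (φ x) (φ (φ x))
  fEABCD≈form E A B C D x = +-cong (+-cong (+-cong (+-cong
    (*-congˡ (*-congˡ (*-identityʳ x)))
    (*-congˡ (trans (^-homo-* x q 1) (*-congˡ (*-identityʳ x)))))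
    (*-congˡ (trans (^-homo-* x (q ℕ.^ 2) 1) (*-cong (x^[q²]≈φ²x x) (*-identityʳ x)))))
    (*-congˡ (x^[2n]≈[xⁿ]² x q)))
    (*-congˡ (trans (x^[2n]≈[xⁿ]² x (q ℕ.^ 2)) (*-cong (x^[q²]≈φ²x x) (x^[q²]≈φ²x x))))

open import Data.Product using (_×_)

theorem2p5 :
  ∀ (q p k : ℕ) → Prime p → ¬ (p ≡ 2) → 1 ≤ k → q ≡ p ^ℕ k →
  (L : FiniteField (q ^ℕ 3)) →
  let open FiniteField L renaming (_×_ to _·_) in
  ∀ a₁ a₂ a₃ b₁ b₂ b₃ c₁ c₂ c₃ →
  InFq q L a₁ → InFq q L a₂ → InFq q L a₃ →
  InFq q L b₁ → InFq q L b₂ → InFq q L b₃ →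
  InFq q L c₁ → InFq q L c₂ → InFq q L c₃ →
  NoNonzeroRoots q L (linP q L a₁ b₁ c₁) →
  NoNonzeroRoots q L (linP q L a₂ b₂ c₂) →
  NoNonzeroRoots q L (linP q L a₃ b₃ c₃) →
  -- condition 1
  (a₁ * a₂ * a₃ ≈ b₁ * b₂ * b₃) × (b₁ * b₂ * b₃ ≈ c₁ * c₂ * c₃) →
  -- condition 2
  (a₁ * a₂ * b₃ + a₁ * b₂ * a₃ + b₁ * a₂ * a₃ ≈ b₁ * b₂ * c₃ + b₁ * c₂ * b₃ + c₁ * b₂ * b₃)
    × (b₁ * b₂ * c₃ + b₁ * c₂ * b₃ + c₁ * b₂ * b₃ ≈ a₁ * c₂ * c₃ + c₁ * c₂ * a₃ + c₁ * a₂ * c₃) →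
  -- condition 3
  (a₁ * a₂ * c₃ + a₁ * c₂ * a₃ + c₁ * a₂ * a₃ ≈ b₁ * c₂ * c₃ + c₁ * c₂ * b₃ + c₁ * b₂ * c₃)
    × (b₁ * c₂ * c₃ + c₁ * c₂ * b₃ + c₁ * b₂ * c₃ ≈ a₁ * b₂ * b₃ + b₁ * a₂ * b₃ + b₁ * b₂ * a₃) →
  let α = a₁ * a₂ * a₃
      β = a₁ * a₂ * b₃ + a₁ * b₂ * a₃ + b₁ * a₂ * a₃
      γ = a₁ * a₂ * c₃ + a₁ * c₂ * a₃ + c₁ * a₂ * a₃
      δ = a₁ * b₂ * c₃ + a₁ * c₂ * b₃ + b₁ * a₂ * c₃ + b₁ * c₂ * a₃ + c₁ * a₂ * b₃ + c₁ * b₂ * a₃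
  in
  ∀ E A B C D →
  InFq q L E → InFq q L A → InFq q L B → InFq q L C → InFq q L D →
  (- (A ^ 2 * D) + A * B * E - B ^ 2 * C ≈ 2 · α) →
  (A ^ 2 * C - A * B * D - 2 · (A * C * D) + 2 · (A * E ^ 2) + B ^ 2 * E
    - 2 · (B * C * E) + 2 · (B * D ^ 2) ≈ 2 · β) →
  (A ^ 2 * E - A * B * C + 2 · (A * C ^ 2) - 2 · (A * D * E) + B ^ 2 * D
    - 2 · (B * C * D) + 2 · (B * E ^ 2) ≈ 2 · γ) →
  (A ^ 3 + B ^ 3 + 4 · (C ^ 3) - 12 · (C * D * E) + 4 · (D ^ 3) + 4 · (E ^ 3) ≈ 2 · δ) →
  Planar q L (fEABCD q L E A B C D)
theorem2p5 q p k p-prime p≢2 _ q≡pᵏ L a₁ a₂ a₃ b₁ b₂ b₃ c₁ c₂ c₃ Fa₁ Fa₂ Fa₃ Fb₁ Fb₂ Fb₃ Fc₁ Fc₂ Fc₃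
           P₁-noRoots P₂-noRoots P₃-noRoots (α≈b³ , b³≈c³) (β≈b²c , b²c≈ac²) (γ≈bc² , bc²≈ab²)
           E A B C D FE FA FB FC FD κ₁≈2α κ₂≈2β κ₃≈2γ κ₄≈2δ =
  planar polarDet≉0 (fEABCD≈form E A B C D)
  where
  open FiniteField L
  open FiniteFieldProperties L
  open FrobeniusOfCubicExtension q p k p-prime q≡pᵏ L
  open RingIdentities commRing
  open CubicExtension L φ-isRingHomomorphism φ³≈id
  open QuadraticForm FE FA FB FC FD

  adjoint≉0 : ∀ {a b c} → Fixed a → Fixed b → Fixed c → NoNonzeroRoots q L (linP q L a b c) →
              ∀ u → ¬ u ≈ 0# → ¬ adjoint a b c u (φ u) (φ (φ u)) ≈ 0#
  adjoint≉0 {a} {b} {c} Fa Fb Fc P-noRoots = LinearisedPolynomial.P*-noNonzeroRoots Fa Fb Fc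
    (λ x x≉0 Px≈0 → P-noRoots x x≉0 (trans (linP≈linearised a b c x) Px≈0))

  adjoint-product≈0 : ∀ u → Quadratic.polarDet E A B C D u (φ u) (φ (φ u)) ≈ 0# →
    adjoint a₁ b₁ c₁ u (φ u) (φ (φ u)) * adjoint a₂ b₂ c₂ u (φ u) (φ (φ u)) * adjoint a₃ b₃ c₃ u (φ u) (φ (φ u)) ≈ 0#
  adjoint-product≈0 u polarDet≈0 = trans (adjoint-product-cyclic u (φ u) (φ (φ u)) α≈b³ b³≈c³ β≈b²c b²c≈ac² γ≈bc² bc²≈ab²)
    (n×1≉0⇒n×x≈0⇒x≈0 {2} (2×1≉0 p≢2) (n×1≉0⇒n×x≈0⇒x≈0 {2} (2×1≉0 p≢2)
      (trans (sym (polarDet-cyclic E A B C D u (φ u) (φ (φ u)) κ₁≈2α κ₂≈2β κ₃≈2γ κ₄≈2δ)) polarDet≈0)))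

  polarDet≉0 : ∀ u → ¬ u ≈ 0# → ¬ Quadratic.polarDet E A B C D u (φ u) (φ (φ u)) ≈ 0#
  polarDet≉0 u u≉0 = x≉0∧y≉0⇒x*y≉0 (x≉0∧y≉0⇒x*y≉0 (adjoint≉0 Fa₁ Fb₁ Fc₁ P₁-noRoots u u≉0)
    (adjoint≉0 Fa₂ Fb₂ Fc₂ P₂-noRoots u u≉0)) (adjoint≉0 Fa₃ Fb₃ Fc₃ P₃-noRoots u u≉0) ∘ adjoint-product≈0 u
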